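{- For every $U \in \Sigma^n$, $\mathrm{ed}(U,\mathrm{SQ}) = \min_{i\in\{0,\dots,n\}}\mathrm{ed}(U[1..i],U[i+1..n])$.
   Context: $U[i..j]=U[i]\cdots U[j]$, empty if $i>j$. SQ is the set of squares (strings $XX$, including the empty string). $\mathrm{ed}$ is edit distance (minimum number of character insertions, deletions and substitutions), and $\mathrm{ed}(U,L)=\min_{V\in L}\mathrm{ed}(U,V)$. -}

module Defs where

open import Data.Nat using (ℕ; zero; suc; _+_; _≤_)
open import Data.List using (List; []; _∷_; _++_; take; drop; length)
open import Relation.Binary.PropositionalEquality using (_≡_)
open import Data.Product using (Σ; _×_; ∃-syntax)

data Cost {A : Set} : List A → List A → ℕ → Set where
  done  : Cost [] [] 0
  match : ∀ {a U V k} → Cost U V k → Cost (a ∷ U) (a ∷ V) k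
  subst : ∀ {a b U V k} → Cost U V k → Cost (a ∷ U) (b ∷ V) (suc k)
  del   : ∀ {a U V k} → Cost U V k → Cost (a ∷ U) V (suc k)
  ins   : ∀ {b U V k} → Cost U V k → Cost U (b ∷ V) (suc k)

IsEd : {A : Set} → List A → List A → ℕ → Set
IsEd U V d = Cost U V d × (∀ k → Cost U V k → d ≤ k)

IsSquare : {A : Set} → List A → Set
IsSquare {A} W = Σ (List A) λ X → W ≡ (X ++ X)

IsEdSQ : {A : Set} → List A → ℕ → Set
IsEdSQ {A} U d =
  (Σ (List A) λ V → IsSquare V × Cost U V d) ×
  (∀ V k → IsSquare V → Cost U V k → d ≤ k)

IsMinSplit : {A : Set} → List A → ℕ → Set
IsMinSplit U d =
  (∃[ i ] (i ≤ length U × IsEd (take i U) (drop i U) d)) ×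
  (∀ i e → i ≤ length U → IsEd (take i U) (drop i U) e → d ≤ e)

-- Cutting an optimal alignment of U against a square X X at the point where the
-- first copy of X ends splits U into U₁ U₂ with U₁ ~ X and U₂ ~ X, so by the
-- triangle inequality ed(U₁, U₂) ≤ ed(U, X X). Conversely an alignment of
-- U[1..i] with U[i+1..n], extended by the identity on U[i+1..n], aligns U with the
-- square U[i+1..n] U[i+1..n] at the same cost.
module Submission where

open import Defs
open import Data.Nat using (ℕ; suc; _+_; _≤_; _<_; s≤s; z≤n; _≤?_)
open import Data.Nat.Properties
open import Data.Nat.Induction using (<-rec)
open import Data.List using (List; []; _∷_; _++_; take; drop; length)
open import Data.List.Properties using (take++drop≡id)
open import Data.Product using (Σ; _×_; _,_)
open import Relation.Nullary using (¬_)
open import Relation.Nullary.Decidable using (decidable-stable)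
open import Relation.Binary.PropositionalEquality
  using (_≡_; refl; cong) renaming (subst to transport)
open import Function.Bundles using (_⇔_; mk⇔)

Least : (ℕ → Set) → Set
Least P = Σ ℕ λ m → P m × (∀ k → P k → m ≤ k)

¬¬-least : ∀ {P : ℕ → Set} {n} → P n → ¬ ¬ Least P
¬¬-least {P} {n} pn noLeast = <-rec (λ m → ¬ P m) noneBelow n pn
  where
  noneBelow : ∀ m → (∀ {k} → k < m → ¬ P k) → ¬ P m
  noneBelow m below pm = noLeast (m , pm , λ k pk → ≮⇒≥ (λ k<m → below k<m pk))

module _ {A : Set} where

  Cost-refl : (X : List A) → Cost X X 0
  Cost-refl []      = done
  Cost-refl (_ ∷ X) = match (Cost-refl X)

  Cost-sym : ∀ {U V k} → Cost {A} U V k → Cost V U k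
  Cost-sym done      = done
  Cost-sym (match c) = match (Cost-sym c)
  Cost-sym (subst c) = subst (Cost-sym c)
  Cost-sym (del c)   = ins (Cost-sym c)
  Cost-sym (ins c)   = del (Cost-sym c)

  Cost-++ : ∀ {U V W Z k l} → Cost {A} U V k → Cost W Z l → Cost (U ++ W) (V ++ Z) (k + l)
  Cost-++ done      d = d
  Cost-++ (match c) d = match (Cost-++ c d)
  Cost-++ (subst c) d = subst (Cost-++ c d)
  Cost-++ (del c)   d = del (Cost-++ c d)
  Cost-++ (ins c)   d = ins (Cost-++ c d)

  CostAtMost : List A → List A → ℕ → Set
  CostAtMost U V b = Σ ℕ λ m → m ≤ b × Cost U V m

  CostAtMost-weaken : ∀ {U V b b′} → b ≤ b′ → CostAtMost U V b → CostAtMost U V b′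
  CostAtMost-weaken b≤b′ (m , m≤b , c) = m , ≤-trans m≤b b≤b′ , c

  CostAtMost-match : ∀ {a U V b} → CostAtMost U V b → CostAtMost (a ∷ U) (a ∷ V) b
  CostAtMost-match (m , m≤b , c) = m , m≤b , match c

  CostAtMost-edit : ∀ {U V U′ V′ b} → (∀ {m} → Cost U V m → Cost U′ V′ (suc m)) →
                    CostAtMost U V b → CostAtMost U′ V′ (suc b)
  CostAtMost-edit op (m , m≤b , c) = suc m , s≤s m≤b , op c

  -- A character inserted by the first alignment and deleted by the second costs nothing.
  Cost-trans : ∀ {U V W k l} → Cost {A} U V k → Cost V W l → CostAtMost U W (k + l)
  Cost-trans done      done      = 0 , z≤n , done
  Cost-trans {k = k} {l = suc l} p (ins q) =
    CostAtMost-weaken (+-monoʳ-< k ≤-refl) (CostAtMost-edit ins (Cost-trans p q))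
  Cost-trans (del p)   q         = CostAtMost-edit del (Cost-trans p q)
  Cost-trans (match p) (match q) = CostAtMost-match (Cost-trans p q)
  Cost-trans {k = k} {l = suc l} (match p) (subst q) =
    CostAtMost-weaken (+-monoʳ-< k ≤-refl) (CostAtMost-edit subst (Cost-trans p q))
  Cost-trans {k = k} {l = suc l} (match p) (del q) =
    CostAtMost-weaken (+-monoʳ-< k ≤-refl) (CostAtMost-edit del (Cost-trans p q))
  Cost-trans (subst p) (match q) = CostAtMost-edit subst (Cost-trans p q)
  Cost-trans {k = suc k} {l = suc l} (subst p) (subst q) =
    CostAtMost-weaken (s≤s (+-monoʳ-≤ k (n≤1+n l))) (CostAtMost-edit subst (Cost-trans p q))
  Cost-trans {k = suc k} {l = suc l} (subst p) (del q) =
    CostAtMost-weaken (s≤s (+-monoʳ-≤ k (n≤1+n l))) (CostAtMost-edit del (Cost-trans p q))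
  Cost-trans (ins p)   (match q) = CostAtMost-edit ins (Cost-trans p q)
  Cost-trans {k = suc k} {l = suc l} (ins p) (subst q) =
    CostAtMost-weaken (s≤s (+-monoʳ-≤ k (n≤1+n l))) (CostAtMost-edit ins (Cost-trans p q))
  Cost-trans {k = suc k} {l = suc l} (ins p) (del q) =
    CostAtMost-weaken (m≤n⇒m≤1+n (+-monoʳ-≤ k (n≤1+n l))) (Cost-trans p q)

  record CostSplit (U X Y : List A) (k : ℕ) : Set where
    constructor cut
    field
      i        : ℕ
      i≤∣U∣    : i ≤ length U
      {k₁ k₂}  : ℕ
      prefix   : Cost (take i U) X k₁
      suffix   : Cost (drop i U) Y k₂
      k₁+k₂≡k : k₁ + k₂ ≡ k

  Cost-split : ∀ {U} X Y {k} → Cost U (X ++ Y) k → CostSplit U X Y k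
  Cost-split []      Y c         = cut 0 z≤n done c refl
  Cost-split (_ ∷ X) Y (match c) with cut i i≤ c₁ c₂ eq ← Cost-split X Y c =
    cut (suc i) (s≤s i≤) (match c₁) c₂ eq
  Cost-split (_ ∷ X) Y (subst c) with cut i i≤ c₁ c₂ eq ← Cost-split X Y c =
    cut (suc i) (s≤s i≤) (subst c₁) c₂ (cong suc eq)
  Cost-split (x ∷ X) Y (del c)   with cut i i≤ c₁ c₂ eq ← Cost-split (x ∷ X) Y c =
    cut (suc i) (s≤s i≤) (del c₁) c₂ (cong suc eq)
  Cost-split (_ ∷ X) Y (ins c)   with cut i i≤ c₁ c₂ eq ← Cost-split X Y c =
    cut i i≤ (ins c₁) c₂ (cong suc eq)

  Cost-square⇒Cost-halves : ∀ {U} X {k} → Cost U (X ++ X) k →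
                            Σ ℕ λ i → i ≤ length U × CostAtMost (take i U) (drop i U) k
  Cost-square⇒Cost-halves X c with cut i i≤ c₁ c₂ eq ← Cost-split X X c =
    i , i≤ , CostAtMost-weaken (≤-reflexive eq) (Cost-trans c₁ (Cost-sym c₂))

  Cost-halves⇒Cost-square : ∀ U i {e} → Cost (take i U) (drop i U) e →
                            Cost U (drop i U ++ drop i U) e
  Cost-halves⇒Cost-square U i {e} c =
    transport (λ W → Cost W (drop i U ++ drop i U) e) (take++drop≡id i U)
      (transport (Cost _ _) (+-identityʳ e) (Cost-++ c (Cost-refl (drop i U))))

mainTheorem19 : {A : Set} (U : List A) (d : ℕ) → IsEdSQ U d ⇔ IsMinSplit U d
mainTheorem19 U d = mk⇔ to from
  where
  to : IsEdSQ U d → IsMinSplit U d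
  to ((_ , (X , refl) , c) , minSquare)
    with i , i≤ , m , m≤d , cm ← Cost-square⇒Cost-halves X c =
    (i , i≤ , transport (Cost _ _) (≤-antisym m≤d (d≤split i m cm)) cm , d≤split i)
    , λ j e _ (ce , _) → d≤split j e ce
    where
    d≤split : ∀ j e → Cost (take j U) (drop j U) e → d ≤ e
    d≤split j e ce = minSquare _ e (drop j U , refl) (Cost-halves⇒Cost-square U j ce)

  from : IsMinSplit U d → IsEdSQ U d
  from ((i , _ , c , _) , minSplit) =
    (_ , (drop i U , refl) , Cost-halves⇒Cost-square U i c) , d≤square
    where
    d≤square : ∀ V k → IsSquare V → Cost U V k → d ≤ k
    d≤square _ k (X , refl) c′ with j , j≤ , m , m≤k , cm ← Cost-square⇒Cost-halves X c′ =
      ≤-trans (decidable-stable (d ≤? m) d≤m) m≤k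
      where
      -- ed(U[1..j], U[j+1..n]) exists only classically; the goal is decidable.
      d≤m : ¬ ¬ (d ≤ m)
      d≤m d≰m = ¬¬-least cm λ (e , ce , least) →
        d≰m (≤-trans (minSplit j e j≤ (ce , least)) (least m cm))
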